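{- Under the assumptions below, the Hermitian matrix $$H = (AD-BC)\begin{pmatrix} C(1-DE) & BCE & C(1-D) & BC \\ BCE & B(1-AE) & BC & B(1-A) \\ C(1-D) & BC & C(1-D) & BC \\ BC & B(1-A) & BC & B(1-A) \end{pmatrix},\qquad E=\frac{A+D-1}{AD-BC},$$ satisfies $T_s^{*} H T_s = H$ for $s=0,1,\infty$, i.e. it is a Hermitian form invariant under the geometric monodromy group $\langle T_0,T_1,T_\infty\rangle$, and its determinant is $$\det H = (BC)^2\,(AD-BC-A-D+1)^3\,(AD-BC)^3.$$
   Context: Consider a rank 4 rigid local system on $\mathbb{P}^1\setminus\{0,1,\infty\}$ (Goursat's case II): matrices $T_0,T_1,T_\infty\in\operatorname{GL}_4(\mathbb{C})$ with $T_0T_1T_\infty=I_4$, where $T_0$, $T_1$, $T_\infty$ are diagonalizable with eigenvalues $1,1,a_1,a_2$; $1,1,b,b$; and $c_1,c_2,c_3,c_4$ respectively (eigenvalues with different labels distinct, $a_1a_2b^2c_1c_2c_3c_4=1$), all eigenvalues lying on the unit circle. In a suitable basis $$T_0 = \begin{pmatrix} 1 & 0 & A(1-a_1) & B(1-a_2) \\ 0 & 1 & C(1-a_1) & D(1-a_2) \\ 0 & 0 & a_1 & 0 \\ 0 & 0 & 0 & a_2 \end{pmatrix},\qquad T_1 = \begin{pmatrix} b & 0 & 0 & 0 \\ 0 & b & 0 & 0 \\ 1-b & 0 & 1 & 0 \\ 0 & 1-b & 0 & 1 \end{pmatrix},$$ and $T_\infty=(T_0T_1)^{ -1}$. The quantities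 $A$, $D$, $BC$ are determined by the eigenvalues and are real in this situation; after conjugating by a diagonal matrix $\operatorname{diag}(\lambda,1,\lambda,1)$ (which sends $(B,C)$ to $(\lambda^{ -1}B,\lambda C)$) one may assume $A,B,C,D$ are all real. The system is assumed irreducible, which is equivalent to $BC(AD-BC)(AD-BC-A-D+1)\neq 0$. -}

module Defs where

open import Level using (Level; _⊔_) renaming (suc to lsuc)
open import Data.Nat using (ℕ) renaming (zero to nzero; suc to nsuc)
open import Data.Fin using (Fin; zero; suc; punchIn; toℕ)
open import Data.Product using (_×_; Σ-syntax)
open import Data.Sum using (_⊎_)
open import Relation.Nullary using (¬_)
open import Algebra.Bundles using (CommutativeRing)

-- A commutative ring with an involution ("complex conjugation") that is a
-- ring automorphism, and with no zero divisors.  ℂ with complex conjugation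
-- is the model the paper works in.
record StarDomain (c ℓ : Level) : Set (lsuc (c ⊔ ℓ)) where
  field
    commRing : CommutativeRing c ℓ
  open CommutativeRing commRing public hiding (zero)
  field
    conj            : Carrier → Carrier
    conj-cong       : ∀ {x y} → x ≈ y → conj x ≈ conj y
    conj-involutive : ∀ x → conj (conj x) ≈ x
    conj-+          : ∀ x y → conj (x + y) ≈ conj x + conj y
    conj-*          : ∀ x y → conj (x * y) ≈ conj x * conj y
    conj-1          : conj 1# ≈ 1#
    no-zero-divisors : ∀ x y → x * y ≈ 0# → x ≈ 0# ⊎ y ≈ 0#
    nontrivial      : ¬ (1# ≈ 0#)

module Matrices {c ℓ : Level} (S : StarDomain c ℓ) where
  open StarDomain S public

  Mat : ℕ → Set c
  Mat n = Fin n → Fin n → Carrier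

  Σ[_] : ∀ {n} → (Fin n → Carrier) → Carrier
  Σ[_] {nzero}  f = 0#
  Σ[_] {nsuc n} f = f zero + Σ[ (λ i → f (suc i)) ]

  infixl 7 _⊗_
  _⊗_ : ∀ {n} → Mat n → Mat n → Mat n
  (M ⊗ N) i j = Σ[ (λ k → M i k * N k j) ]

  _ᴴ : ∀ {n} → Mat n → Mat n
  (M ᴴ) i j = conj (M j i)

  I : ∀ {n} → Mat n
  I zero    zero    = 1#
  I zero    (suc j) = 0#
  I (suc i) zero    = 0#
  I (suc i) (suc j) = I i j

  diag : ∀ {n} → (Fin n → Carrier) → Mat n
  diag d i j = d i * I i j

  infix 4 _≈M_
  _≈M_ : ∀ {n} → Mat n → Mat n → Set ℓ
  M ≈M N = ∀ i j → M i j ≈ N i j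

  sgn : ℕ → Carrier
  sgn nzero    = 1#
  sgn (nsuc k) = - sgn k

  det : ∀ {n} → Mat n → Carrier
  det {nzero}  M = 1#
  det {nsuc n} M = Σ[ (λ j → sgn (toℕ j) * (M zero j * det (λ i k → M (suc i) (punchIn j k)))) ]

  mat4 : (a b c d e f g h i j k l m n o p : Carrier) → Mat 4
  mat4 a b c d e f g h i j k l m n o p = λ where
    zero zero → a ; zero (suc zero) → b ; zero (suc (suc zero)) → c ; zero (suc (suc (suc zero))) → d
    (suc zero) zero → e ; (suc zero) (suc zero) → f ; (suc zero) (suc (suc zero)) → g ; (suc zero) (suc (suc (suc zero))) → h
    (suc (suc zero)) zero → i ; (suc (suc zero)) (suc zero) → j ; (suc (suc zero)) (suc (suc zero)) → k ; (suc (suc zero)) (suc (suc (suc zero))) → l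
    (suc (suc (suc zero))) zero → m ; (suc (suc (suc zero))) (suc zero) → n ; (suc (suc (suc zero))) (suc (suc zero)) → o ; (suc (suc (suc zero))) (suc (suc (suc zero))) → p

  T₀ : (A B C D a₁ a₂ : Carrier) → Mat 4
  T₀ A B C D a₁ a₂ = mat4
    1# 0# (A * (1# - a₁)) (B * (1# - a₂))
    0# 1# (C * (1# - a₁)) (D * (1# - a₂))
    0# 0# a₁ 0#
    0# 0# 0# a₂

  T₁ : (b : Carrier) → Mat 4
  T₁ b = mat4
    b 0# 0# 0#
    0# b 0# 0#
    (1# - b) 0# 1# 0#
    0# (1# - b) 0# 1#

  -- the Hermitian form H, with E = (A+D-1)/(AD-BC) passed as an argument
  Hform : (A B C D E : Carrier) → Mat 4
  Hform A B C D E = λ i j → (A * D - B * C) * M i j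
    where
    M : Mat 4
    M = mat4
      (C * (1# - D * E)) (B * C * E) (C * (1# - D)) (B * C)
      (B * C * E) (B * (1# - A * E)) (B * C) (B * (1# - A))
      (C * (1# - D)) (B * C) (C * (1# - D)) (B * C)
      (B * C) (B * (1# - A)) (B * C) (B * (1# - A))

  Diagonalizable : Mat 4 → (Fin 4 → Carrier) → Set (c ⊔ ℓ)
  Diagonalizable T d = Σ[ P ∈ Mat 4 ] Σ[ Q ∈ Mat 4 ] ((P ⊗ Q) ≈M I × T ≈M ((P ⊗ diag d) ⊗ Q))

  Unit : Carrier → Set ℓ
  Unit x = conj x * x ≈ 1#

  vec4 : Carrier → Carrier → Carrier → Carrier → Fin 4 → Carrier
  vec4 x y z w zero = x
  vec4 x y z w (suc zero) = y
  vec4 x y z w (suc (suc zero)) = z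
  vec4 x y z w (suc (suc (suc zero))) = w

module Submission where

-- The Hermitian form H of Goursat's case II is verified by reducing every
-- claim to a polynomial identity in A, B, C, D and the eigenvalues, which a
-- ring solver checks over an arbitrary commutative ring.
--
-- T₀ and T₁ preserve Hx up to multiples of |a₁|²-1,
--   |a₂|²-1, |b|²-1, which vanish on the unit circle; T∞ = (T₀T₁)⁻¹ then
--   preserves Hx too, and det Hx factors as claimed.

open import Defs
open import Level using (Level; 0ℓ)
open import Algebra.Bundles using (CommutativeRing; RawRing)
open import Algebra.Solver.Ring.AlmostCommutativeRing using (fromCommutativeRing; _-Raw-AlmostCommutative⟶_)
open import Data.Nat as ℕ using (ℕ; _∸_) renaming (zero to nzero; suc to nsuc)
open import Data.Fin using (Fin; zero; suc; punchIn; toℕ; combine; remQuot; _↑ʳ_)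
open import Data.Fin.Patterns using (0F; 1F; 2F; 3F; 4F; 5F; 6F; 7F)
open import Data.Maybe using (Maybe; just; nothing)
open import Data.Product using (_×_; _,_; uncurry)
open import Data.Product.Properties using (≡-dec)
open import Data.Vec using (Vec; []; _∷_; tabulate)
open import Relation.Binary.Bundles using (Setoid)
open import Relation.Binary.PropositionalEquality as ≡ using (_≡_)
open import Relation.Nullary using (¬_; yes; no)

module IntegerCoefficients {c ℓ : Level} (R : CommutativeRing c ℓ) where
  open CommutativeRing R
  open import Algebra.Properties.Ring ring using (-0#≈0#; ⁻¹-anti-homo‿-; -‿+-comm; x[y-z]≈xy-xz; [y-z]x≈yx-zx)
  open import Algebra.Properties.CommutativeSemigroup +-commutativeSemigroup using (interchange)
  open import Algebra.Properties.Semiring.Mult.TCOptimised semiring using (1+×; ×-homo-+; ×1-homo-*) renaming (_×_ to _·_)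
  open import Relation.Binary.Reasoning.Setoid setoid

  [x+y]-[u+v] : ∀ x y u v → (x + y) - (u + v) ≈ (x - u) + (y - v)
  [x+y]-[u+v] x y u v = trans (+-congˡ (sym (-‿+-comm u v))) (interchange x y (- u) (- v))

  [1+x]-[1+y] : ∀ x y → (1# + x) - (1# + y) ≈ x - y
  [1+x]-[1+y] x y = begin
    (1# + x) - (1# + y) ≈⟨ [x+y]-[u+v] 1# x 1# y ⟩
    (1# - 1#) + (x - y) ≈⟨ +-congʳ (-‿inverseʳ 1#) ⟩
    0# + (x - y)        ≈⟨ +-identityˡ _ ⟩
    x - y               ∎

  [xu+yv]-[xv+yu] : ∀ x y u v → (x * u + y * v) - (x * v + y * u) ≈ (x - y) * (u - v)
  [xu+yv]-[xv+yu] x y u v = begin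
    (x * u + y * v) - (x * v + y * u)   ≈⟨ +-congˡ (-‿cong (+-comm (x * v) (y * u))) ⟩
    (x * u + y * v) - (y * u + x * v)   ≈⟨ [x+y]-[u+v] (x * u) (y * v) (y * u) (x * v) ⟩
    (x * u - y * u) + (y * v - x * v)   ≈⟨ +-congˡ (sym (⁻¹-anti-homo‿- (x * v) (y * v))) ⟩
    (x * u - y * u) - (x * v - y * v)   ≈⟨ +-cong (sym ([y-z]x≈yx-zx u x y)) (-‿cong (sym ([y-z]x≈yx-zx v x y))) ⟩
    (x - y) * u - (x - y) * v           ≈⟨ sym (x[y-z]≈xy-xz (x - y) u v) ⟩
    (x - y) * (u - v)                   ∎

  -- Integers as differences m - n of natural numbers, kept in the
  -- canonical form where one component is zero.
  ℤ₋ : Set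
  ℤ₋ = ℕ × ℕ

  canonical : ℕ → ℕ → ℤ₋
  canonical m n = (m ∸ n , n ∸ m)

  ℤ₋-rawRing : RawRing 0ℓ 0ℓ
  ℤ₋-rawRing = record
    { Carrier = ℤ₋
    ; _≈_ = _≡_
    ; _+_ = λ { (m , n) (m′ , n′) → canonical (m ℕ.+ m′) (n ℕ.+ n′) }
    ; _*_ = λ { (m , n) (m′ , n′) → canonical (m ℕ.* m′ ℕ.+ n ℕ.* n′) (m ℕ.* n′ ℕ.+ n ℕ.* m′) }
    ; -_ = λ { (m , n) → (n , m) }
    ; 0# = (0 , 0)
    ; 1# = (1 , 0)
    }

  -- The image of m - n in R.  The clauses make the images of 0 and 1
  -- definitionally 0# and 1#, so solver constants agree with ring constants.
  ⟦_⟧ℤ : ℤ₋ → Carrier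
  ⟦ m , nzero ⟧ℤ = m · 1#
  ⟦ nzero , nsuc n ⟧ℤ = - (nsuc n · 1#)
  ⟦ nsuc m , nsuc n ⟧ℤ = ⟦ m , n ⟧ℤ

  ⟦⟧ℤ-difference : ∀ m n → ⟦ m , n ⟧ℤ ≈ m · 1# - n · 1#
  ⟦⟧ℤ-difference m nzero = sym (trans (+-congˡ -0#≈0#) (+-identityʳ _))
  ⟦⟧ℤ-difference nzero (nsuc n) = sym (+-identityˡ _)
  ⟦⟧ℤ-difference (nsuc m) (nsuc n) = begin
    ⟦ m , n ⟧ℤ                           ≈⟨ ⟦⟧ℤ-difference m n ⟩
    m · 1# - n · 1#                      ≈⟨ sym ([1+x]-[1+y] (m · 1#) (n · 1#)) ⟩
    (1# + m · 1#) - (1# + n · 1#)        ≈⟨ sym (+-cong (1+× m 1#) (-‿cong (1+× n 1#))) ⟩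
    nsuc m · 1# - nsuc n · 1#            ∎

  ⟦⟧ℤ-canonical : ∀ m n → ⟦ canonical m n ⟧ℤ ≈ ⟦ m , n ⟧ℤ
  ⟦⟧ℤ-canonical nzero    nzero    = refl
  ⟦⟧ℤ-canonical nzero    (nsuc n) = refl
  ⟦⟧ℤ-canonical (nsuc m) nzero    = refl
  ⟦⟧ℤ-canonical (nsuc m) (nsuc n) = ⟦⟧ℤ-canonical m n

  homomorphism : ℤ₋-rawRing -Raw-AlmostCommutative⟶ fromCommutativeRing R
  homomorphism = record
    { ⟦_⟧ = ⟦_⟧ℤ
    ; +-homo = +-homo
    ; *-homo = *-homo
    ; -‿homo = -‿homo
    ; 0-homo = refl
    ; 1-homo = refl
    }
    where
    +-homo : ∀ x y → ⟦ RawRing._+_ ℤ₋-rawRing x y ⟧ℤ ≈ ⟦ x ⟧ℤ + ⟦ y ⟧ℤ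
    +-homo (m , n) (m′ , n′) = begin
      ⟦ canonical (m ℕ.+ m′) (n ℕ.+ n′) ⟧ℤ        ≈⟨ trans (⟦⟧ℤ-canonical (m ℕ.+ m′) (n ℕ.+ n′)) (⟦⟧ℤ-difference (m ℕ.+ m′) (n ℕ.+ n′)) ⟩
      (m ℕ.+ m′) · 1# - (n ℕ.+ n′) · 1#           ≈⟨ +-cong (×-homo-+ 1# m m′) (-‿cong (×-homo-+ 1# n n′)) ⟩
      (m · 1# + m′ · 1#) - (n · 1# + n′ · 1#)     ≈⟨ [x+y]-[u+v] _ _ _ _ ⟩
      (m · 1# - n · 1#) + (m′ · 1# - n′ · 1#)     ≈⟨ sym (+-cong (⟦⟧ℤ-difference m n) (⟦⟧ℤ-difference m′ n′)) ⟩
      ⟦ m , n ⟧ℤ + ⟦ m′ , n′ ⟧ℤ                   ∎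
    *-homo : ∀ x y → ⟦ RawRing._*_ ℤ₋-rawRing x y ⟧ℤ ≈ ⟦ x ⟧ℤ * ⟦ y ⟧ℤ
    *-homo (m , n) (m′ , n′) = begin
      ⟦ canonical (m ℕ.* m′ ℕ.+ n ℕ.* n′) (m ℕ.* n′ ℕ.+ n ℕ.* m′) ⟧ℤ
        ≈⟨ trans (⟦⟧ℤ-canonical P Q) (⟦⟧ℤ-difference P Q) ⟩
      (m ℕ.* m′ ℕ.+ n ℕ.* n′) · 1# - (m ℕ.* n′ ℕ.+ n ℕ.* m′) · 1#
        ≈⟨ +-cong (trans (×-homo-+ 1# (m ℕ.* m′) (n ℕ.* n′)) (+-cong (×1-homo-* m m′) (×1-homo-* n n′)))
                  (-‿cong (trans (×-homo-+ 1# (m ℕ.* n′) (n ℕ.* m′)) (+-cong (×1-homo-* m n′) (×1-homo-* n m′)))) ⟩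
      (M * M′ + N * N′) - (M * N′ + N * M′)
        ≈⟨ [xu+yv]-[xv+yu] M N M′ N′ ⟩
      (M - N) * (M′ - N′)
        ≈⟨ sym (*-cong (⟦⟧ℤ-difference m n) (⟦⟧ℤ-difference m′ n′)) ⟩
      ⟦ m , n ⟧ℤ * ⟦ m′ , n′ ⟧ℤ ∎
      where
      P = m ℕ.* m′ ℕ.+ n ℕ.* n′; Q = m ℕ.* n′ ℕ.+ n ℕ.* m′
      M = m · 1#; N = n · 1#; M′ = m′ · 1#; N′ = n′ · 1#
    -‿homo : ∀ x → ⟦ RawRing.-_ ℤ₋-rawRing x ⟧ℤ ≈ - ⟦ x ⟧ℤ
    -‿homo (m , n) = begin
      ⟦ n , m ⟧ℤ           ≈⟨ ⟦⟧ℤ-difference n m ⟩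
      n · 1# - m · 1#      ≈⟨ sym (⁻¹-anti-homo‿- (m · 1#) (n · 1#)) ⟩
      - (m · 1# - n · 1#)  ≈⟨ -‿cong (sym (⟦⟧ℤ-difference m n)) ⟩
      - ⟦ m , n ⟧ℤ         ∎

  -- Syntactically equal coefficients have equal images; this weak
  -- decision procedure is all the solver needs.
  _≟ℤ_ : ∀ x y → Maybe (⟦ x ⟧ℤ ≈ ⟦ y ⟧ℤ)
  x ≟ℤ y with ≡-dec ℕ._≟_ ℕ._≟_ x y
  ... | yes ≡.refl = just refl
  ... | no _       = nothing

  open import Algebra.Solver.Ring ℤ₋-rawRing (fromCommutativeRing R) homomorphism _≟ℤ_ public
    using (Polynomial; con; var; _:+_; _:*_; :-_; prove)

  syntaxRing : ℕ → RawRing 0ℓ 0ℓ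
  syntaxRing n = record
    { Carrier = Polynomial n ; _≈_ = _≡_ ; _+_ = _:+_ ; _*_ = _:*_ ; -_ = :-_
    ; 0# = con (0 , 0) ; 1# = con (1 , 0) }

-- Over the ring itself these are values; over syntaxRing they are the
-- expressions handed to the solver, which evaluate back to the values.
module MatrixExpressions {a ℓ : Level} (R : RawRing a ℓ) where
  open RawRing R public using (Carrier; _+_; _*_; -_; 0#; 1#)

  infixl 6 _-_
  _-_ : Carrier → Carrier → Carrier
  x - y = x + - y

  Mat : ℕ → Set a
  Mat n = Fin n → Fin n → Carrier

  Σ : ∀ {n} → (Fin n → Carrier) → Carrier
  Σ {nzero}  f = 0#
  Σ {nsuc n} f = f zero + Σ (λ i → f (suc i))

  infixl 7 _⊗_
  _⊗_ : ∀ {n} → Mat n → Mat n → Mat n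
  (M ⊗ N) i j = Σ (λ k → M i k * N k j)

  ⟨_,_⟩ : ∀ {n} → Mat n → Mat n → Carrier
  ⟨ Z , M ⟩ = Σ (λ k → Σ (λ l → Z k l * M k l))

  sgn : ℕ → Carrier
  sgn nzero    = 1#
  sgn (nsuc k) = - sgn k

  det : ∀ {n} → Mat n → Carrier
  det {nzero}  M = 1#
  det {nsuc n} M = Σ (λ j → sgn (toℕ j) * (M zero j * det (λ i k → M (suc i) (punchIn j k))))

  mat4 : (a b c d e f g h i j k l m n o p : Carrier) → Mat 4
  mat4 a b c d e f g h i j k l m n o p = λ where
    0F 0F → a ; 0F 1F → b ; 0F 2F → c ; 0F 3F → d
    1F 0F → e ; 1F 1F → f ; 1F 2F → g ; 1F 3F → h
    2F 0F → i ; 2F 1F → j ; 2F 2F → k ; 2F 3F → l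
    3F 0F → m ; 3F 1F → n ; 3F 2F → o ; 3F 3F → p

  T₀ : (A B C D a₁ a₂ : Carrier) → Mat 4
  T₀ A B C D a₁ a₂ = mat4
    1# 0# (A * (1# - a₁)) (B * (1# - a₂))
    0# 1# (C * (1# - a₁)) (D * (1# - a₂))
    0# 0# a₁ 0#
    0# 0# 0# a₂

  T₁ : (b : Carrier) → Mat 4
  T₁ b = mat4
    b 0# 0# 0#
    0# b 0# 0#
    (1# - b) 0# 1# 0#
    0# (1# - b) 0# 1#

  -- The adjoints of T₀ and T₁ for real A, B, C, D, written in terms of the
  -- conjugate eigenvalues a₁′, a₂′, b′.
  T₀ᴴ : (A B C D a₁′ a₂′ : Carrier) → Mat 4
  T₀ᴴ A B C D a₁′ a₂′ = mat4
    1# 0# 0# 0#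
    0# 1# 0# 0#
    (A * (1# - a₁′)) (C * (1# - a₁′)) a₁′ 0#
    (B * (1# - a₂′)) (D * (1# - a₂′)) 0# a₂′

  T₁ᴴ : (b′ : Carrier) → Mat 4
  T₁ᴴ b′ = mat4
    b′ 0# (1# - b′) 0#
    0# b′ 0# (1# - b′)
    0# 0# 1# 0#
    0# 0# 0# 1#

  Hform : (A B C D E : Carrier) → Mat 4
  Hform A B C D E i j = (A * D - B * C) * mat4
    (C * (1# - D * E)) (B * C * E) (C * (1# - D)) (B * C)
    (B * C * E) (B * (1# - A * E)) (B * C) (B * (1# - A))
    (C * (1# - D)) (B * C) (C * (1# - D)) (B * C)
    (B * C) (B * (1# - A)) (B * C) (B * (1# - A)) i j

  -- The form H with (AD - BC)E replaced by A + D - 1: a polynomial matrix in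
  -- A, B, C, D which is visibly symmetric.
  Hx : (A B C D : Carrier) → Mat 4
  Hx A B C D = mat4
    (Δ * C - C * D * F) (B * C * F) (Δ * (C * (1# - D))) (Δ * (B * C))
    (B * C * F) (Δ * B - A * B * F) (Δ * (B * C)) (Δ * (B * (1# - A)))
    (Δ * (C * (1# - D))) (Δ * (B * C)) (Δ * (C * (1# - D))) (Δ * (B * C))
    (Δ * (B * C)) (Δ * (B * (1# - A))) (Δ * (B * C)) (Δ * (B * (1# - A)))
    where
    Δ F : Carrier
    Δ = A * D - B * C
    F = A + D - 1#

  Γ : (A B C D : Carrier) → Carrier
  Γ A B C D = A * D - B * C - A - D + 1#

  -- The coefficient matrices by which the identities below fail when E, a₁,
  -- a₂ or b are unconstrained: each is multiplied by the corresponding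
  -- relation (AD-BC)E = A+D-1, a₁′a₁ = 1, a₂′a₂ = 1, b′b = 1.
  Q : (A B C D : Carrier) → Mat 4
  Q A B C D = mat4
    (C * D) (- (B * C)) 0# 0#
    (- (B * C)) (A * B) 0# 0#
    0# 0# 0# 0#
    0# 0# 0# 0#

  K₁ K₂ : (A B C D : Carrier) → Mat 4
  K₁ A B C D = mat4
    0# 0# 0# 0#
    0# 0# 0# 0#
    0# 0# (C * (A * D - B * C) * Γ A B C D) 0#
    0# 0# 0# 0#
  K₂ A B C D = mat4
    0# 0# 0# 0#
    0# 0# 0# 0#
    0# 0# 0# 0#
    0# 0# 0# (B * (A * D - B * C) * Γ A B C D)

  detHx : (A B C D : Carrier) → Carrier
  detHx A B C D = ((B * C) * (B * C)) * (Γ A B C D * Γ A B C D * Γ A B C D) * ((A * D - B * C) * (A * D - B * C) * (A * D - B * C))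

module Development {c ℓ : Level} (S : StarDomain c ℓ) where
  open Matrices S
  open import Algebra.Properties.Ring ring using (+-inverseʳ-unique; x+x≈x⇒x≈0)
  open import Algebra.Properties.CommutativeSemigroup +-commutativeSemigroup using (interchange)
  import Relation.Binary.Reasoning.Setoid as SetoidReasoning
  module ≈-Reasoning = SetoidReasoning setoid
  open IntegerCoefficients commRing using (syntaxRing; var; prove)
  module V = MatrixExpressions rawRing
  module Syn (n : ℕ) = MatrixExpressions (syntaxRing n)

  conj-0 : conj 0# ≈ 0#
  conj-0 = x+x≈x⇒x≈0 (conj 0#) (trans (sym (conj-+ 0# 0#)) (conj-cong (+-identityʳ 0#)))

  conj-neg : ∀ x → conj (- x) ≈ - conj x
  conj-neg x = +-inverseʳ-unique (conj x) (conj (- x))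
    (trans (sym (conj-+ x (- x))) (trans (conj-cong (-‿inverseʳ x)) conj-0))

  conj-sub : ∀ x y → conj (x - y) ≈ conj x - conj y
  conj-sub x y = trans (conj-+ x (- y)) (+-congˡ (conj-neg y))

  Real : Carrier → Set ℓ
  Real x = conj x ≈ x

  real-1 : Real 1#
  real-1 = conj-1

  real-+ : ∀ {x y} → Real x → Real y → Real (x + y)
  real-+ {x} {y} rx ry = trans (conj-+ x y) (+-cong rx ry)

  real-* : ∀ {x y} → Real x → Real y → Real (x * y)
  real-* {x} {y} rx ry = trans (conj-* x y) (*-cong rx ry)

  real-- : ∀ {x y} → Real x → Real y → Real (x - y)
  real-- {x} {y} rx ry = trans (conj-sub x y) (+-cong rx (-‿cong ry))

  Σ-cong : ∀ {n} {f g : Fin n → Carrier} → (∀ i → f i ≈ g i) → Σ[ f ] ≈ Σ[ g ]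
  Σ-cong {nzero}  e = refl
  Σ-cong {nsuc n} e = +-cong (e zero) (Σ-cong (λ i → e (suc i)))

  Σ-0 : ∀ n → Σ[ (λ (i : Fin n) → 0#) ] ≈ 0#
  Σ-0 nzero    = refl
  Σ-0 (nsuc n) = trans (+-identityˡ _) (Σ-0 n)

  Σ-+ : ∀ {n} (f g : Fin n → Carrier) → Σ[ (λ i → f i + g i) ] ≈ Σ[ f ] + Σ[ g ]
  Σ-+ {nzero}  f g = sym (+-identityʳ 0#)
  Σ-+ {nsuc n} f g = trans (+-congˡ (Σ-+ (λ i → f (suc i)) (λ i → g (suc i)))) (interchange _ _ _ _)

  Σ-*ˡ : ∀ {n} x (f : Fin n → Carrier) → x * Σ[ f ] ≈ Σ[ (λ i → x * f i) ]
  Σ-*ˡ {nzero}  x f = zeroʳ x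
  Σ-*ˡ {nsuc n} x f = trans (distribˡ x _ _) (+-congˡ (Σ-*ˡ x (λ i → f (suc i))))

  Σ-*ʳ : ∀ {n} x (f : Fin n → Carrier) → Σ[ f ] * x ≈ Σ[ (λ i → f i * x) ]
  Σ-*ʳ {nzero}  x f = zeroˡ x
  Σ-*ʳ {nsuc n} x f = trans (distribʳ x _ _) (+-congˡ (Σ-*ʳ x (λ i → f (suc i))))

  Σ-swap : ∀ {m n} (f : Fin m → Fin n → Carrier) →
           Σ[ (λ i → Σ[ (λ j → f i j) ]) ] ≈ Σ[ (λ j → Σ[ (λ i → f i j) ]) ]
  Σ-swap {nzero}  {n} f = sym (Σ-0 n)
  Σ-swap {nsuc m} {n} f = trans (+-congˡ (Σ-swap (λ i j → f (suc i) j)))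
                                (sym (Σ-+ (f zero) (λ j → Σ[ (λ i → f (suc i) j) ])))

  conj-Σ : ∀ {n} (f : Fin n → Carrier) → conj Σ[ f ] ≈ Σ[ (λ i → conj (f i)) ]
  conj-Σ {nzero}  f = conj-0
  conj-Σ {nsuc n} f = trans (conj-+ _ _) (+-congˡ (conj-Σ (λ i → f (suc i))))

  Σ-Iˡ : ∀ {n} (i : Fin n) (f : Fin n → Carrier) → Σ[ (λ k → I i k * f k) ] ≈ f i
  Σ-Iˡ {nsuc n} zero f = begin
    1# * f zero + Σ[ (λ k → 0# * f (suc k)) ] ≈⟨ +-cong (*-identityˡ _) (Σ-cong (λ k → zeroˡ (f (suc k)))) ⟩
    f zero + Σ[ (λ (k : Fin n) → 0#) ]        ≈⟨ +-congˡ (Σ-0 n) ⟩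
    f zero + 0#                                ≈⟨ +-identityʳ _ ⟩
    f zero                                     ∎
    where open ≈-Reasoning
  Σ-Iˡ (suc i) f = trans (+-cong (zeroˡ (f zero)) (Σ-Iˡ i (λ k → f (suc k)))) (+-identityˡ _)

  Σ-Iʳ : ∀ {n} (j : Fin n) (f : Fin n → Carrier) → Σ[ (λ k → f k * I k j) ] ≈ f j
  Σ-Iʳ j f = trans (Σ-cong (λ k → trans (*-comm (f k) (I k j)) (*-congʳ (I-symmetric k j)))) (Σ-Iˡ j f)
    where
    I-symmetric : ∀ {n} (k l : Fin n) → I k l ≈ I l k
    I-symmetric zero    zero    = refl
    I-symmetric zero    (suc l) = refl
    I-symmetric (suc k) zero    = refl
    I-symmetric (suc k) (suc l) = I-symmetric k l

  ≈M-refl : ∀ {n} {M : Mat n} → M ≈M M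
  ≈M-refl i j = refl

  ≈M-sym : ∀ {n} {M N : Mat n} → M ≈M N → N ≈M M
  ≈M-sym e i j = sym (e i j)

  ≈M-trans : ∀ {n} {M N P : Mat n} → M ≈M N → N ≈M P → M ≈M P
  ≈M-trans e e′ i j = trans (e i j) (e′ i j)

  Mat-setoid : ℕ → Setoid c ℓ
  Mat-setoid n = record
    { Carrier = Mat n
    ; _≈_ = _≈M_
    ; isEquivalence = record { refl = ≈M-refl ; sym = ≈M-sym ; trans = ≈M-trans } }

  module ≈M-Reasoning {n : ℕ} = SetoidReasoning (Mat-setoid n)

  ⊗-cong : ∀ {n} {M M′ N N′ : Mat n} → M ≈M M′ → N ≈M N′ → M ⊗ N ≈M M′ ⊗ N′
  ⊗-cong e e′ i j = Σ-cong (λ k → *-cong (e i k) (e′ k j))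

  ⊗-assoc : ∀ {n} (M N P : Mat n) → (M ⊗ N) ⊗ P ≈M M ⊗ (N ⊗ P)
  ⊗-assoc M N P i j = begin
    Σ[ (λ k → Σ[ (λ l → M i l * N l k) ] * P k j) ]    ≈⟨ Σ-cong (λ k → Σ-*ʳ (P k j) (λ l → M i l * N l k)) ⟩
    Σ[ (λ k → Σ[ (λ l → M i l * N l k * P k j) ]) ]    ≈⟨ Σ-swap (λ k l → M i l * N l k * P k j) ⟩
    Σ[ (λ l → Σ[ (λ k → M i l * N l k * P k j) ]) ]    ≈⟨ Σ-cong (λ l → Σ-cong (λ k → *-assoc (M i l) (N l k) (P k j))) ⟩
    Σ[ (λ l → Σ[ (λ k → M i l * (N l k * P k j)) ]) ]  ≈⟨ Σ-cong (λ l → sym (Σ-*ˡ (M i l) (λ k → N l k * P k j))) ⟩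
    Σ[ (λ l → M i l * Σ[ (λ k → N l k * P k j) ]) ]    ∎
    where open ≈-Reasoning

  I-⊗ : ∀ {n} (M : Mat n) → I ⊗ M ≈M M
  I-⊗ M i j = Σ-Iˡ i (λ k → M k j)

  ⊗-I : ∀ {n} (M : Mat n) → M ⊗ I ≈M M
  ⊗-I M i j = Σ-Iʳ j (λ k → M i k)

  ᴴ-cong : ∀ {n} {M N : Mat n} → M ≈M N → M ᴴ ≈M N ᴴ
  ᴴ-cong e i j = conj-cong (e j i)

  ᴴ-⊗ : ∀ {n} (M N : Mat n) → (M ⊗ N) ᴴ ≈M (N ᴴ) ⊗ (M ᴴ)
  ᴴ-⊗ M N i j = trans (conj-Σ (λ k → M j k * N k i))
                      (Σ-cong (λ k → trans (conj-* (M j k) (N k i)) (*-comm _ _)))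

  Iᴴ : ∀ {n} → (I {n}) ᴴ ≈M I
  Iᴴ zero    zero    = conj-1
  Iᴴ zero    (suc j) = conj-0
  Iᴴ (suc i) zero    = conj-0
  Iᴴ (suc i) (suc j) = Iᴴ i j

  det-cong : ∀ {n} {M N : Mat n} → M ≈M N → det M ≈ det N
  det-cong {nzero}  e = refl
  det-cong {nsuc n} e = Σ-cong (λ j → *-congˡ {sgn (toℕ j)} (*-cong (e zero j) (det-cong (λ i k → e (suc i) (punchIn j k)))))

  ⟨_,_⟩ : ∀ {n} → Mat n → Mat n → Carrier
  ⟨ Z , M ⟩ = Σ[ (λ k → Σ[ (λ l → Z k l * M k l) ]) ]

  pairing-unit : ∀ {n} (M : Mat n) i j → ⟨ (λ k l → I i k * I j l) , M ⟩ ≈ M i j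
  pairing-unit M i j = begin
    Σ[ (λ k → Σ[ (λ l → I i k * I j l * M k l) ]) ]  ≈⟨ Σ-cong (λ k → Σ-cong (λ l → *-assoc (I i k) (I j l) (M k l))) ⟩
    Σ[ (λ k → Σ[ (λ l → I i k * (I j l * M k l)) ]) ] ≈⟨ Σ-cong (λ k → sym (Σ-*ˡ (I i k) (λ l → I j l * M k l))) ⟩
    Σ[ (λ k → I i k * Σ[ (λ l → I j l * M k l) ]) ]   ≈⟨ Σ-Iˡ i (λ k → Σ[ (λ l → I j l * M k l) ]) ⟩
    Σ[ (λ l → I j l * M i l) ]                        ≈⟨ Σ-Iˡ j (M i) ⟩
    M i j                                             ∎
    where open ≈-Reasoning

  pairing-determines : ∀ {n} {M N : Mat n} → (∀ Z → ⟨ Z , M ⟩ ≈ ⟨ Z , N ⟩) → M ≈M N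
  pairing-determines {M = M} {N} e i j =
    trans (sym (pairing-unit M i j)) (trans (e (λ k l → I i k * I j l)) (pairing-unit N i j))

  defect-vanishes : ∀ {n} (N K : Mat n) {p q} → p ≈ q → (λ i j → N i j + K i j * (p - q)) ≈M N
  defect-vanishes N K {p} {q} p≈q i j = begin
    N i j + K i j * (p - q)  ≈⟨ +-congˡ (*-congˡ (trans (+-congʳ p≈q) (-‿inverseʳ q))) ⟩
    N i j + K i j * 0#       ≈⟨ +-congˡ (zeroʳ (K i j)) ⟩
    N i j + 0#               ≈⟨ +-identityʳ (N i j) ⟩
    N i j                    ∎
    where open ≈-Reasoning

  Invariant : ∀ {n} → Mat n → Mat n → Set ℓ
  Invariant H T = (T ᴴ) ⊗ H ⊗ T ≈M H

  invariant-resp : ∀ {n} {H H′ : Mat n} (T : Mat n) → H ≈M H′ → Invariant H T → Invariant H′ T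
  invariant-resp {H = H} {H′} T H≈H′ inv = begin
    (T ᴴ) ⊗ H′ ⊗ T  ≈⟨ ⊗-cong (⊗-cong ≈M-refl (≈M-sym H≈H′)) ≈M-refl ⟩
    (T ᴴ) ⊗ H ⊗ T   ≈⟨ inv ⟩
    H               ≈⟨ H≈H′ ⟩
    H′              ∎
    where open ≈M-Reasoning

  conjugate-by-product : ∀ {n} (H X Y : Mat n) →
    ((X ⊗ Y) ᴴ) ⊗ H ⊗ (X ⊗ Y) ≈M (Y ᴴ) ⊗ ((X ᴴ) ⊗ H ⊗ X) ⊗ Y
  conjugate-by-product H X Y = begin
    ((X ⊗ Y) ᴴ) ⊗ H ⊗ (X ⊗ Y)         ≈⟨ ⊗-cong (⊗-cong (ᴴ-⊗ X Y) ≈M-refl) ≈M-refl ⟩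
    (Y ᴴ) ⊗ (X ᴴ) ⊗ H ⊗ (X ⊗ Y)       ≈⟨ ≈M-sym (⊗-assoc _ X Y) ⟩
    (Y ᴴ) ⊗ (X ᴴ) ⊗ H ⊗ X ⊗ Y         ≈⟨ ⊗-cong (⊗-cong (⊗-assoc (Y ᴴ) (X ᴴ) H) ≈M-refl) ≈M-refl ⟩
    (Y ᴴ) ⊗ ((X ᴴ) ⊗ H) ⊗ X ⊗ Y       ≈⟨ ⊗-cong (⊗-assoc (Y ᴴ) ((X ᴴ) ⊗ H) X) ≈M-refl ⟩
    (Y ᴴ) ⊗ ((X ᴴ) ⊗ H ⊗ X) ⊗ Y       ∎
    where open ≈M-Reasoning

  invariant-⊗ : ∀ {n} {H X Y : Mat n} → Invariant H X → Invariant H Y → Invariant H (X ⊗ Y)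
  invariant-⊗ {H = H} {X} {Y} inv-X inv-Y = begin
    ((X ⊗ Y) ᴴ) ⊗ H ⊗ (X ⊗ Y)    ≈⟨ conjugate-by-product H X Y ⟩
    (Y ᴴ) ⊗ ((X ᴴ) ⊗ H ⊗ X) ⊗ Y  ≈⟨ ⊗-cong (⊗-cong ≈M-refl inv-X) ≈M-refl ⟩
    (Y ᴴ) ⊗ H ⊗ Y                ≈⟨ inv-Y ⟩
    H                            ∎
    where open ≈M-Reasoning

  invariant-inverse : ∀ {n} {H X Y : Mat n} → Invariant H X → X ⊗ Y ≈M I → Invariant H Y
  invariant-inverse {H = H} {X} {Y} inv-X XY≈I = begin
    (Y ᴴ) ⊗ H ⊗ Y                ≈⟨ ⊗-cong (⊗-cong ≈M-refl (≈M-sym inv-X)) ≈M-refl ⟩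
    (Y ᴴ) ⊗ ((X ᴴ) ⊗ H ⊗ X) ⊗ Y  ≈⟨ ≈M-sym (conjugate-by-product H X Y) ⟩
    ((X ⊗ Y) ᴴ) ⊗ H ⊗ (X ⊗ Y)    ≈⟨ ⊗-cong (⊗-cong (ᴴ-cong XY≈I) ≈M-refl) XY≈I ⟩
    (I ᴴ) ⊗ H ⊗ I                ≈⟨ ⊗-I _ ⟩
    (I ᴴ) ⊗ H                    ≈⟨ ⊗-cong Iᴴ ≈M-refl ⟩
    I ⊗ H                        ≈⟨ I-⊗ H ⟩
    H                            ∎
    where open ≈M-Reasoning

  adjoint-replace : ∀ {n} (T T′ H : Mat n) → T ᴴ ≈M T′ → T ᴴ ⊗ H ⊗ T ≈M T′ ⊗ H ⊗ T
  adjoint-replace T T′ H e = ⊗-cong (⊗-cong e ≈M-refl) ≈M-refl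

  RowEq : Mat 4 → Mat 4 → Fin 4 → Set ℓ
  RowEq M N r = M r 0F ≈ N r 0F × M r 1F ≈ N r 1F × M r 2F ≈ N r 2F × M r 3F ≈ N r 3F

  entrywise : ∀ {M N : Mat 4} → (∀ r → RowEq M N r) → M ≈M N
  entrywise rows r 0F = let (e , _ , _ , _) = rows r in e
  entrywise rows r 1F = let (_ , e , _ , _) = rows r in e
  entrywise rows r 2F = let (_ , _ , e , _) = rows r in e
  entrywise rows r 3F = let (_ , _ , _ , e) = rows r in e

  conj-1- : ∀ x → conj (1# - x) ≈ 1# - conj x
  conj-1- x = trans (conj-sub 1# x) (+-congʳ conj-1)

  conj-scaled : ∀ {X} → Real X → ∀ x → conj (X * (1# - x)) ≈ X * (1# - conj x)
  conj-scaled {X} rX x = trans (conj-* X (1# - x)) (*-cong rX (conj-1- x))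

  -- Matrix identities are checked in one go by pairing with a generic test
  -- matrix whose 16 entries are extra solver variables.

  testMatrix : ∀ k → Syn.Mat (k ℕ.+ 16) 4
  testMatrix k i j = var (k ↑ʳ combine i j)

  -- The entries of Z, listed in the order of the variables of testMatrix.
  entries : Mat 4 → Vec Carrier 16
  entries Z = tabulate (λ x → uncurry Z (remQuot 4 x))

  Hform-identity : ∀ A B C D E Z →
    ⟨ Z , Hform A B C D E ⟩ ≈ ⟨ Z , (λ i j → V.Hx A B C D i j + V.Q A B C D i j * ((A + D - 1#) - (A * D - B * C) * E)) ⟩
  Hform-identity A B C D E Z = prove (A ∷ B ∷ C ∷ D ∷ E ∷ entries Z)
    X.⟨ testMatrix 5 , X.Hform vA vB vC vD vE ⟩
    X.⟨ testMatrix 5 , (λ i j → X.Hx vA vB vC vD i j X.+ X.Q vA vB vC vD i j X.* ((vA X.+ vD X.- X.1#) X.- (vA X.* vD X.- vB X.* vC) X.* vE)) ⟩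
    refl
    where
    module X = Syn 21
    vA = var 0F; vB = var 1F; vC = var 2F; vD = var 3F; vE = var 4F

  T₀-identity : ∀ A B C D a₁ a₁′ a₂ a₂′ Z →
    ⟨ Z , V.T₀ᴴ A B C D a₁′ a₂′ ⊗ V.Hx A B C D ⊗ T₀ A B C D a₁ a₂ ⟩ ≈
    ⟨ Z , (λ i j → V.Hx A B C D i j + V.K₁ A B C D i j * (a₁′ * a₁ - 1#) + V.K₂ A B C D i j * (a₂′ * a₂ - 1#)) ⟩
  T₀-identity A B C D a₁ a₁′ a₂ a₂′ Z = prove (A ∷ B ∷ C ∷ D ∷ a₁ ∷ a₁′ ∷ a₂ ∷ a₂′ ∷ entries Z)
    X.⟨ testMatrix 8 , X.T₀ᴴ vA vB vC vD va₁′ va₂′ X.⊗ X.Hx vA vB vC vD X.⊗ X.T₀ vA vB vC vD va₁ va₂ ⟩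
    X.⟨ testMatrix 8 , (λ i j → X.Hx vA vB vC vD i j X.+ X.K₁ vA vB vC vD i j X.* (va₁′ X.* va₁ X.- X.1#)
                                                   X.+ X.K₂ vA vB vC vD i j X.* (va₂′ X.* va₂ X.- X.1#)) ⟩
    refl
    where
    module X = Syn 24
    vA = var 0F; vB = var 1F; vC = var 2F; vD = var 3F
    va₁ = var 4F; va₁′ = var 5F; va₂ = var 6F; va₂′ = var 7F

  T₁-identity : ∀ A B C D b b′ Z →
    ⟨ Z , V.T₁ᴴ b′ ⊗ V.Hx A B C D ⊗ T₁ b ⟩ ≈
    ⟨ Z , (λ i j → V.Hx A B C D i j + V.Γ A B C D * V.Q A B C D i j * (b′ * b - 1#)) ⟩
  T₁-identity A B C D b b′ Z = prove (A ∷ B ∷ C ∷ D ∷ b ∷ b′ ∷ entries Z)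
    X.⟨ testMatrix 6 , X.T₁ᴴ vb′ X.⊗ X.Hx vA vB vC vD X.⊗ X.T₁ vb ⟩
    X.⟨ testMatrix 6 , (λ i j → X.Hx vA vB vC vD i j X.+ X.Γ vA vB vC vD X.* X.Q vA vB vC vD i j X.* (vb′ X.* vb X.- X.1#)) ⟩
    refl
    where
    module X = Syn 22
    vA = var 0F; vB = var 1F; vC = var 2F; vD = var 3F; vb = var 4F; vb′ = var 5F

  det-identity : ∀ A B C D → det (V.Hx A B C D) ≈ V.detHx A B C D
  det-identity A B C D = prove (A ∷ B ∷ C ∷ D ∷ [])
    (X.det (X.Hx vA vB vC vD)) (X.detHx vA vB vC vD) refl
    where
    module X = Syn 4
    vA = var 0F; vB = var 1F; vC = var 2F; vD = var 3F

  Hform-explicit : ∀ {A B C D E} → (A * D - B * C) * E ≈ A + D - 1# → Hform A B C D E ≈M V.Hx A B C D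
  Hform-explicit {A} {B} {C} {D} {E} ΔE≈F =
    ≈M-trans (pairing-determines (Hform-identity A B C D E))
             (defect-vanishes (V.Hx A B C D) (V.Q A B C D) (sym ΔE≈F))

  Hx-hermitian : ∀ {A B C D} → Real A → Real B → Real C → Real D → V.Hx A B C D ᴴ ≈M V.Hx A B C D
  Hx-hermitian rA rB rC rD = entrywise λ where
      0F → r₀₀ , r₀₁ , r₀₂ , r₀₃
      1F → r₀₁ , r₁₁ , r₀₃ , r₁₃
      2F → r₀₂ , r₀₃ , r₀₂ , r₀₃
      3F → r₀₃ , r₁₃ , r₀₃ , r₁₃
    where
    rΔ  = real-- (real-* rA rD) (real-* rB rC)
    rF  = real-- (real-+ rA rD) real-1
    r₀₀ = real-- (real-* rΔ rC) (real-* (real-* rC rD) rF)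
    r₀₁ = real-* (real-* rB rC) rF
    r₀₂ = real-* rΔ (real-* rC (real-- real-1 rD))
    r₀₃ = real-* rΔ (real-* rB rC)
    r₁₁ = real-- (real-* rΔ rB) (real-* (real-* rA rB) rF)
    r₁₃ = real-* rΔ (real-* rB (real-- real-1 rA))

  T₀-invariant : ∀ {A B C D} a₁ a₂ → Real A → Real B → Real C → Real D → Unit a₁ → Unit a₂ →
    Invariant (V.Hx A B C D) (T₀ A B C D a₁ a₂)
  T₀-invariant {A} {B} {C} {D} a₁ a₂ rA rB rC rD u₁ u₂ = begin
    T₀ A B C D a₁ a₂ ᴴ ⊗ V.Hx A B C D ⊗ T₀ A B C D a₁ a₂
      ≈⟨ adjoint-replace (T₀ A B C D a₁ a₂) (V.T₀ᴴ A B C D (conj a₁) (conj a₂)) (V.Hx A B C D) T₀-adjoint ⟩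
    V.T₀ᴴ A B C D (conj a₁) (conj a₂) ⊗ V.Hx A B C D ⊗ T₀ A B C D a₁ a₂
      ≈⟨ pairing-determines (T₀-identity A B C D a₁ (conj a₁) a₂ (conj a₂)) ⟩
    (λ i j → V.Hx A B C D i j + V.K₁ A B C D i j * (conj a₁ * a₁ - 1#) + V.K₂ A B C D i j * (conj a₂ * a₂ - 1#))
      ≈⟨ defect-vanishes _ (V.K₂ A B C D) u₂ ⟩
    (λ i j → V.Hx A B C D i j + V.K₁ A B C D i j * (conj a₁ * a₁ - 1#))
      ≈⟨ defect-vanishes _ (V.K₁ A B C D) u₁ ⟩
    V.Hx A B C D ∎
    where
    open ≈M-Reasoning
    T₀-adjoint : T₀ A B C D a₁ a₂ ᴴ ≈M V.T₀ᴴ A B C D (conj a₁) (conj a₂)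
    T₀-adjoint = entrywise λ where
      0F → conj-1 , conj-0 , conj-0 , conj-0
      1F → conj-0 , conj-1 , conj-0 , conj-0
      2F → conj-scaled rA a₁ , conj-scaled rC a₁ , refl , conj-0
      3F → conj-scaled rB a₂ , conj-scaled rD a₂ , conj-0 , refl

  T₁-invariant : ∀ A B C D b → Unit b → Invariant (V.Hx A B C D) (T₁ b)
  T₁-invariant A B C D b u = begin
    T₁ b ᴴ ⊗ V.Hx A B C D ⊗ T₁ b
      ≈⟨ adjoint-replace (T₁ b) (V.T₁ᴴ (conj b)) (V.Hx A B C D) T₁-adjoint ⟩
    V.T₁ᴴ (conj b) ⊗ V.Hx A B C D ⊗ T₁ b
      ≈⟨ pairing-determines (T₁-identity A B C D b (conj b)) ⟩
    (λ i j → V.Hx A B C D i j + V.Γ A B C D * V.Q A B C D i j * (conj b * b - 1#))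
      ≈⟨ defect-vanishes _ (λ i j → V.Γ A B C D * V.Q A B C D i j) u ⟩
    V.Hx A B C D ∎
    where
    open ≈M-Reasoning
    T₁-adjoint : T₁ b ᴴ ≈M V.T₁ᴴ (conj b)
    T₁-adjoint = entrywise λ where
      0F → refl , conj-0 , conj-1- b , conj-0
      1F → conj-0 , refl , conj-0 , conj-1- b
      2F → conj-0 , conj-0 , conj-1 , conj-0
      3F → conj-0 , conj-0 , conj-0 , conj-1

mainTheorem2 : ∀ {c ℓ : Level} (S : StarDomain c ℓ) →
    let open Matrices S in
    (A B C D a₁ a₂ b E : Carrier) (c₁ c₂ c₃ c₄ : Carrier) (T∞ : Mat 4) →
    conj A ≈ A → conj B ≈ B → conj C ≈ C → conj D ≈ D →
    Unit a₁ → Unit a₂ → Unit b → Unit c₁ → Unit c₂ → Unit c₃ → Unit c₄ →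
    ¬ (a₁ ≈ 1#) → ¬ (a₂ ≈ 1#) → ¬ (a₁ ≈ a₂) → ¬ (b ≈ 1#) → ¬ (b ≈ a₁) → ¬ (b ≈ a₂) →
    ¬ (c₁ ≈ c₂) → ¬ (c₁ ≈ c₃) → ¬ (c₁ ≈ c₄) → ¬ (c₂ ≈ c₃) → ¬ (c₂ ≈ c₄) → ¬ (c₃ ≈ c₄) →
    ¬ (c₁ ≈ 1#) → ¬ (c₂ ≈ 1#) → ¬ (c₃ ≈ 1#) → ¬ (c₄ ≈ 1#) →
    ¬ (c₁ ≈ a₁) → ¬ (c₂ ≈ a₁) → ¬ (c₃ ≈ a₁) → ¬ (c₄ ≈ a₁) →
    ¬ (c₁ ≈ a₂) → ¬ (c₂ ≈ a₂) → ¬ (c₃ ≈ a₂) → ¬ (c₄ ≈ a₂) →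
    ¬ (c₁ ≈ b) → ¬ (c₂ ≈ b) → ¬ (c₃ ≈ b) → ¬ (c₄ ≈ b) →
    a₁ * a₂ * b * b * c₁ * c₂ * c₃ * c₄ ≈ 1# →
    T₀ A B C D a₁ a₂ ⊗ T₁ b ⊗ T∞ ≈M I →
    Diagonalizable T∞ (vec4 c₁ c₂ c₃ c₄) →
    ¬ ((B * C) * (A * D - B * C) * (A * D - B * C - A - D + 1#) ≈ 0#) →
    (A * D - B * C) * E ≈ A + D - 1# →
    (Hform A B C D E ᴴ) ≈M Hform A B C D E
    × (T₀ A B C D a₁ a₂ ᴴ) ⊗ Hform A B C D E ⊗ T₀ A B C D a₁ a₂ ≈M Hform A B C D E
    × (T₁ b ᴴ) ⊗ Hform A B C D E ⊗ T₁ b ≈M Hform A B C D E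
    × (T∞ ᴴ) ⊗ Hform A B C D E ⊗ T∞ ≈M Hform A B C D E
    × det (Hform A B C D E) ≈ ((B * C) * (B * C)) * ((A * D - B * C - A - D + 1#) * (A * D - B * C - A - D + 1#) * (A * D - B * C - A - D + 1#)) * ((A * D - B * C) * (A * D - B * C) * (A * D - B * C))
mainTheorem2 S A B C D a₁ a₂ b E c₁ c₂ c₃ c₄ T∞ rA rB rC rD u₁ u₂ ub
  _ _ _ _ _ _ _ _ _ _ _ _ _ _ _ _ _ _ _ _ _ _ _ _ _ _ _ _ _ _ _ _ _ T₀T₁T∞≈I _ _ ΔE≈F =
  hermitian , to-H T₀′ inv₀ , to-H T₁′ inv₁ , to-H T∞ inv∞ , determinant
  where
  open Matrices S
  open Development S
  H Hx T₀′ T₁′ : Mat 4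
  H = Hform A B C D E
  Hx = V.Hx A B C D
  T₀′ = T₀ A B C D a₁ a₂
  T₁′ = T₁ b

  H≈Hx : H ≈M Hx
  H≈Hx = Hform-explicit ΔE≈F

  to-H : ∀ T → Invariant Hx T → Invariant H T
  to-H T = invariant-resp T (≈M-sym H≈Hx)

  inv₀ : Invariant Hx T₀′
  inv₀ = T₀-invariant a₁ a₂ rA rB rC rD u₁ u₂
  inv₁ : Invariant Hx T₁′
  inv₁ = T₁-invariant A B C D b ub
  inv∞ : Invariant Hx T∞
  inv∞ = invariant-inverse {X = T₀′ ⊗ T₁′} {Y = T∞} (invariant-⊗ {X = T₀′} {Y = T₁′} inv₀ inv₁) T₀T₁T∞≈I

  hermitian : H ᴴ ≈M H
  hermitian = ≈M-trans (ᴴ-cong {M = H} H≈Hx) (≈M-trans (Hx-hermitian rA rB rC rD) (≈M-sym H≈Hx))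

  determinant : det H ≈ V.detHx A B C D
  determinant = trans (det-cong H≈Hx) (det-identity A B C D)
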